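{- Let $L$ be an $\mathbb{F}_q$-linear set of $\mathrm{PG}(1,q^n)$ with exactly two points $P$ and $Q$ of weight greater than one. Then $w_L(P)\le \frac n2$ and $w_L(Q)\le\frac n2$. In particular, if $n$ is odd then $w_L(P)+w_L(Q)<n$. Moreover, if $w_L(P)+w_L(Q)=n$ then $n$ is even and $w_L(P)=w_L(Q)=\frac n2$.
   Context: An $\mathbb{F}_q$-linear set of $\mathrm{PG}(1,q^n)=\mathrm{PG}(\mathbb{F}_{q^n}^2,\mathbb{F}_{q^n})$ is a set $L=L_U=\{\langle \mathbf u\rangle_{\mathbb{F}_{q^n}}\colon \mathbf u\in U\setminus\{\mathbf 0\}\}$ for an $\mathbb{F}_q$-subspace $U$ of $\mathbb{F}_{q^n}^2$; the weight of a point $\langle\mathbf v\rangle_{\mathbb{F}_{q^n}}$ is $w_L(\langle\mathbf v\rangle_{\mathbb{F}_{q^n}})=\dim_{\mathbb{F}_q}(U\cap\langle\mathbf v\rangle_{\mathbb{F}_{q^n}})$. -}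

module Defs where

open import Level using (Level; _⊔_) renaming (suc to lsuc)
open import Algebra.Bundles using (CommutativeRing)
open import Data.Nat using (ℕ; zero; suc; _<_)
open import Data.Fin using (Fin; zero; suc)
open import Data.Product using (Σ; ∃; _×_; _,_)
open import Relation.Nullary using (¬_)
open import Data.Unit using (⊤)
open import Relation.Binary.PropositionalEquality using (_≡_)

record Field (c ℓ : Level) : Set (lsuc (c ⊔ ℓ)) where
  field
    commutativeRing : CommutativeRing c ℓ
  open CommutativeRing commutativeRing public
  field
    0≉1     : ¬ (0# ≈ 1#)
    inverse : ∀ x → ¬ (x ≈ 0#) → ∃ λ y → x * y ≈ 1#

module FieldTheory {c ℓ : Level} (K : Field c ℓ) where
  open Field K using (Carrier; _≈_; _+_; _*_; -_; 0#; 1#)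

  record IsSubfield {p : Level} (F : Carrier → Set p) : Set (c ⊔ ℓ ⊔ p) where
    field
      resp  : ∀ {x y} → x ≈ y → F x → F y
      has0  : F 0#
      has1  : F 1#
      +-cl  : ∀ {x y} → F x → F y → F (x + y)
      neg-cl : ∀ {x} → F x → F (- x)
      *-cl  : ∀ {x y} → F x → F y → F (x * y)
      inv-cl : ∀ {x y} → F x → x * y ≈ 1# → F y

  HasSize : ∀ {p} → (Carrier → Set p) → ℕ → Set (c ⊔ ℓ ⊔ p)
  HasSize F q = Σ (Fin q → Carrier) λ e →
      (∀ i → F (e i))
    × (∀ x → F x → ∃ λ i → e i ≈ x)
    × (∀ i j → e i ≈ e j → i ≡ j)

  module OverSubfield {p : Level} (F : Carrier → Set p)
           {v e : Level} (V : Set v) (_≈V_ : V → V → Set e)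
           (0V : V) (_+V_ : V → V → V) (_·_ : Carrier → V → V) where

    lincomb : ∀ {k} → (Fin k → Carrier) → (Fin k → V) → V
    lincomb {zero}  a b = 0V
    lincomb {suc k} a b = (a zero · b zero) +V lincomb (λ i → a (suc i)) (λ i → b (suc i))

    FCoeffs : ∀ {k} → (Fin k → Carrier) → Set p
    FCoeffs a = ∀ i → F (a i)

    LinIndep : ∀ {k} → (Fin k → V) → Set (c ⊔ ℓ ⊔ p ⊔ e)
    LinIndep b = ∀ a → FCoeffs a → lincomb a b ≈V 0V → ∀ i → a i ≈ 0#

    Spans : ∀ {s k} → (V → Set s) → (Fin k → V) → Set (c ⊔ p ⊔ e ⊔ v ⊔ s)
    Spans S b = ∀ x → S x → ∃ λ a → FCoeffs a × lincomb a b ≈V x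

    IsBasis : ∀ {s k} → (V → Set s) → (Fin k → V) → Set (c ⊔ ℓ ⊔ p ⊔ e ⊔ v ⊔ s)
    IsBasis S b = (∀ i → S (b i)) × LinIndep b × Spans S b

    HasDim : ∀ {s} → (V → Set s) → ℕ → Set (c ⊔ ℓ ⊔ p ⊔ e ⊔ v ⊔ s)
    HasDim S k = Σ (Fin k → V) λ b → IsBasis S b

    record IsSubspace {s : Level} (S : V → Set s) : Set (c ⊔ p ⊔ e ⊔ v ⊔ s) where
      field
        resp  : ∀ {x y} → x ≈V y → S x → S y
        has0  : S 0V
        +-cl  : ∀ {x y} → S x → S y → S (x +V y)
        ·-cl  : ∀ {a x} → F a → S x → S (a · x)

  K² : Set c
  K² = Carrier × Carrier

  _≈₂_ : K² → K² → Set ℓ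
  (x₁ , x₂) ≈₂ (y₁ , y₂) = (x₁ ≈ y₁) × (x₂ ≈ y₂)

  0₂ : K²
  0₂ = 0# , 0#

  _+₂_ : K² → K² → K²
  (x₁ , x₂) +₂ (y₁ , y₂) = (x₁ + y₁) , (x₂ + y₂)

  _·₂_ : Carrier → K² → K²
  a ·₂ (x₁ , x₂) = (a * x₁) , (a * x₂)

  Span₁ : K² → K² → Set (c ⊔ ℓ)
  Span₁ v x = ∃ λ μ → x ≈₂ (μ ·₂ v)

  -- u and v (nonzero) define the same point of PG(1,q^n)
  SamePoint : K² → K² → Set (c ⊔ ℓ)
  SamePoint u v = ∃ λ μ → u ≈₂ (μ ·₂ v)

  module Linear {p : Level} (F : Carrier → Set p) where
    module OnK  = OverSubfield F Carrier _≈_ 0# _+_ _*_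
    module OnK² = OverSubfield F K² _≈₂_ 0₂ _+₂_ _·₂_

    Degree : ℕ → Set (c ⊔ ℓ ⊔ p)
    Degree n = OnK.HasDim (λ _ → ⊤) n

    Weight : ∀ {u} → (K² → Set u) → K² → ℕ → Set (c ⊔ ℓ ⊔ p ⊔ u)
    Weight U v w = OnK².HasDim (λ x → U x × Span₁ v x) w

    WeightGt1 : ∀ {u} → (K² → Set u) → K² → Set (c ⊔ ℓ ⊔ p ⊔ u)
    WeightGt1 U v = ∃ λ w → 1 < w × Weight U v w

module Submission where

-- Write μ₁, …, μ_w for the coordinates, relative to P, of an F-basis of U ∩ ⟨P⟩, and ν₁, ν₂ for those of two
-- F-independent vectors of U ∩ ⟨Q⟩. The 2w elements μᵢν₂ and −μᵢν₁ of K are F-independent, so 2w ≤ n = [K : F]: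
-- a dependence among them gives d, e in the F-span of the μᵢ with dν₂ = eν₁, and if d ≠ 0 then dP + ν₁Q and
-- eP + ν₂Q are F-independent vectors of U on a single point, a third point of weight greater than one. So d = 0,
-- hence e = 0 and the dependence is trivial. Exchanging P and Q bounds w_Q; the rest is arithmetic.

open import Defs
open import Level using (Level; _⊔_)
import Data.Nat as ℕ
import Data.Nat.Properties as ℕ
open import Data.Nat.Divisibility using (_∣_; divides)
open import Data.Fin using (Fin; zero; suc; _↑ˡ_; _↑ʳ_; splitAt; join; funToFin; finToFun; combine)
import Data.Fin.Properties as Fin
open import Data.Vec.Functional using (_∷_; []; _++_; take; drop)
import Data.Vec.Functional.Properties as Vector
open import Data.Product using (∃; _×_; _,_; proj₁; proj₂)
open import Data.Product.Relation.Binary.Pointwise.NonDependent using (×-setoid)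
open import Relation.Binary.Bundles using (Setoid)
open import Data.Sum using (_⊎_; inj₁; inj₂; swap)
open import Data.Empty using (⊥-elim)
open import Data.Unit using (tt)
open import Function using (_∘_)
open import Relation.Nullary using (¬_; Dec; yes; no)
open import Relation.Nullary.Decidable using (map′; _×-dec_)
import Relation.Binary.PropositionalEquality as ≡
open import Relation.Binary.PropositionalEquality using (_≡_; _≢_; _≗_)

funToFin-cong : ∀ {m q} {f g : Fin m → Fin q} → f ≗ g → funToFin f ≡ funToFin g
funToFin-cong {ℕ.zero}  f≗g = ≡.refl
funToFin-cong {ℕ.suc m} f≗g = ≡.cong₂ combine (f≗g zero) (funToFin-cong (f≗g ∘ suc))

funToFin-injective : ∀ {m q} {f g : Fin m → Fin q} → funToFin f ≡ funToFin g → f ≗ g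
funToFin-injective {f = f} {g} eq i = ≡.trans (≡.sym (Fin.finToFun-funToFin f i))
  (≡.trans (≡.cong (λ j → finToFun j i) eq) (Fin.finToFun-funToFin g i))

pointwise-injection⇒≤ : ∀ {k m q} → 2 ℕ.≤ q → (f : (Fin k → Fin q) → (Fin m → Fin q)) →
                        (∀ γ γ′ → f γ ≗ f γ′ → γ ≗ γ′) → k ℕ.≤ m
pointwise-injection⇒≤ {k} {m} {q} 2≤q f f-injective = ℕ.≮⇒≥ λ m<k →
  ℕ.<⇒≱ (ℕ.^-monoʳ-< q 2≤q m<k) (Fin.injective⇒≤ code-injective)
  where
  code : Fin (q ℕ.^ k) → Fin (q ℕ.^ m)
  code = funToFin ∘ f ∘ finToFun
  code-injective : ∀ {i j} → code i ≡ code j → i ≡ j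
  code-injective {i} {j} eq = ≡.trans (≡.sym (Fin.funToFin-finToFin {k} {q} i))
    (≡.trans (funToFin-cong (f-injective _ _ (funToFin-injective eq))) (Fin.funToFin-finToFin {k} {q} j))

any-word? : ∀ {k q p} {P : (Fin k → Fin q) → Set p} →
            (∀ {γ γ′} → γ ≗ γ′ → P γ → P γ′) → (∀ γ → Dec (P γ)) → Dec (∃ P)
any-word? resp P? = map′ (λ (i , p) → finToFun i , p)
  (λ (γ , p) → funToFin γ , resp (≡.sym ∘ Fin.finToFun-funToFin γ) p)
  (Fin.any? (P? ∘ finToFun))

distinct⇒2≤ : ∀ {m} {i j : Fin m} → i ≢ j → 2 ℕ.≤ m
distinct⇒2≤ {1} {zero} {zero} i≢j = ⊥-elim (i≢j ≡.refl)
distinct⇒2≤ {ℕ.suc (ℕ.suc m)} _ = ℕ.s≤s (ℕ.s≤s ℕ.z≤n)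

↑-elim : ∀ {m n p} (P : Fin (m ℕ.+ n) → Set p) →
         (∀ i → P (i ↑ˡ n)) → (∀ i → P (m ↑ʳ i)) → ∀ j → P j
↑-elim {m} {n} P left right j = ≡.subst P (Fin.join-splitAt m n j) (onSplit (splitAt m j))
  where
  onSplit : (s : Fin m ⊎ Fin n) → P (join m n s)
  onSplit (inj₁ i) = left i
  onSplit (inj₂ i) = right i

module FieldProperties {c ℓ : Level} (K : Field c ℓ) where
  open Field K hiding (zero)
  open import Algebra.Properties.Ring ring public
  open import Algebra.Properties.CommutativeSemigroup +-commutativeSemigroup public
    using () renaming (interchange to +-interchange)
  open import Relation.Binary.Reasoning.Setoid setoid

  x≈0⇒x*y≈0 : ∀ {x} y → x ≈ 0# → x * y ≈ 0#
  x≈0⇒x*y≈0 y x≈0 = trans (*-congʳ x≈0) (zeroˡ y)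

  x≈0⇒x+y≈0⇒y≈0 : ∀ {x y} → x ≈ 0# → x + y ≈ 0# → y ≈ 0#
  x≈0⇒x+y≈0⇒y≈0 {x} {y} x≈0 x+y≈0 = trans (sym (+-identityˡ y)) (trans (+-congʳ (sym x≈0)) x+y≈0)

  y≈ax⇒x≈a⁻¹y : ∀ {a a⁻¹ x y} → a * a⁻¹ ≈ 1# → y ≈ a * x → x ≈ a⁻¹ * y
  y≈ax⇒x≈a⁻¹y {a} {a⁻¹} {x} {y} aa⁻¹≈1 y≈ax = begin
    x              ≈⟨ *-identityˡ x ⟨
    1# * x         ≈⟨ *-congʳ aa⁻¹≈1 ⟨
    (a * a⁻¹) * x  ≈⟨ *-congʳ (*-comm a a⁻¹) ⟩
    (a⁻¹ * a) * x  ≈⟨ *-assoc a⁻¹ a x ⟩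
    a⁻¹ * (a * x)  ≈⟨ *-congˡ y≈ax ⟨
    a⁻¹ * y        ∎

  ax+r≈0⇒x≈-a⁻¹r : ∀ {a a⁻¹ x r} → a * a⁻¹ ≈ 1# → a * x + r ≈ 0# → x ≈ (- a⁻¹) * r
  ax+r≈0⇒x≈-a⁻¹r {a} {a⁻¹} {x} {r} aa⁻¹≈1 ax+r≈0 = begin
    x              ≈⟨ y≈ax⇒x≈a⁻¹y aa⁻¹≈1 (sym (+-inverseˡ-unique (a * x) r ax+r≈0)) ⟩
    a⁻¹ * (- r)    ≈⟨ -‿distribʳ-* a⁻¹ r ⟨
    - (a⁻¹ * r)    ≈⟨ -‿distribˡ-* a⁻¹ r ⟩
    (- a⁻¹) * r    ∎

  x+0*y≈x : ∀ x y → x + 0# * y ≈ x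
  x+0*y≈x x y = trans (+-congˡ (zeroˡ y)) (+-identityʳ x)

  0*x+y≈y : ∀ x y → 0# * x + y ≈ y
  0*x+y≈y x y = trans (+-congʳ (zeroˡ x)) (+-identityˡ y)

  *-cancelˡ-≉0 : ∀ {x y} → ¬ x ≈ 0# → x * y ≈ 0# → y ≈ 0#
  *-cancelˡ-≉0 {x} {y} x≉0 xy≈0 =
    let x⁻¹ , xx⁻¹≈1 = inverse x x≉0
    in trans (y≈ax⇒x≈a⁻¹y xx⁻¹≈1 (sym xy≈0)) (zeroʳ x⁻¹)

  [x-x′]a+[y-y′]b≈0 : ∀ {x x′ y y′ a b} → x * a + y * b ≈ x′ * a + y′ * b →
                      (x - x′) * a + (y - y′) * b ≈ 0#
  [x-x′]a+[y-y′]b≈0 {x} {x′} {y} {y′} {a} {b} eq = begin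
    (x - x′) * a + (y - y′) * b              ≈⟨ +-cong ([y-z]x≈yx-zx a x x′) ([y-z]x≈yx-zx b y y′) ⟩
    (x * a - x′ * a) + (y * b - y′ * b)      ≈⟨ +-interchange _ _ _ _ ⟩
    (x * a + y * b) + (- (x′ * a) - y′ * b)  ≈⟨ +-congˡ (-‿+-comm (x′ * a) (y′ * b)) ⟩
    (x * a + y * b) - (x′ * a + y′ * b)      ≈⟨ x≈y⇒x∙y⁻¹≈ε eq ⟩
    0#                                       ∎

module Plane {c ℓ : Level} (K : Field c ℓ) where
  open Field K hiding (zero)
  open FieldProperties K
  open FieldTheory K

  module K² = Setoid (×-setoid setoid setoid)

  SamePoint-sym : ∀ {u v} → ¬ v ≈₂ 0₂ → SamePoint v u → SamePoint u v
  SamePoint-sym {u} {v} v≉0 (m , v≈mu) =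
    let m⁻¹ , mm⁻¹≈1 = inverse m m≉0
    in m⁻¹ , y≈ax⇒x≈a⁻¹y mm⁻¹≈1 (proj₁ v≈mu) , y≈ax⇒x≈a⁻¹y mm⁻¹≈1 (proj₂ v≈mu)
    where
    m≉0 : ¬ m ≈ 0#
    m≉0 m≈0 = v≉0 (trans (proj₁ v≈mu) (x≈0⇒x*y≈0 _ m≈0) , trans (proj₂ v≈mu) (x≈0⇒x*y≈0 _ m≈0))

module Combinations {c ℓ p : Level} (K : Field c ℓ) {F : Field.Carrier K → Set p}
                    (F-subfield : FieldTheory.IsSubfield K F) where
  open Field K hiding (zero)
  open FieldProperties K
  open FieldTheory K
  open Plane K
  open Linear F
  open OnK using (lincomb; FCoeffs; LinIndep)
  open OnK² using () renaming (lincomb to lincomb₂; LinIndep to LinIndep₂)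
  open import Relation.Binary.Reasoning.Setoid setoid
  private
    module Sub = IsSubfield F-subfield

  lincomb-cong : ∀ {k} {a a′ b b′ : Fin k → Carrier} →
                 (∀ i → a i ≈ a′ i) → (∀ i → b i ≈ b′ i) → lincomb a b ≈ lincomb a′ b′
  lincomb-cong {ℕ.zero}  a≈a′ b≈b′ = refl
  lincomb-cong {ℕ.suc k} a≈a′ b≈b′ =
    +-cong (*-cong (a≈a′ zero) (b≈b′ zero)) (lincomb-cong (a≈a′ ∘ suc) (b≈b′ ∘ suc))

  lincomb-+ˡ : ∀ {k} (a a′ b : Fin k → Carrier) →
               lincomb (λ i → a i + a′ i) b ≈ lincomb a b + lincomb a′ b
  lincomb-+ˡ {ℕ.zero}  a a′ b = sym (+-identityˡ 0#)
  lincomb-+ˡ {ℕ.suc k} a a′ b =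
    trans (+-cong (distribʳ _ _ _) (lincomb-+ˡ (a ∘ suc) (a′ ∘ suc) (b ∘ suc))) (+-interchange _ _ _ _)

  lincomb-*ˡ : ∀ {k} x (a b : Fin k → Carrier) → lincomb (λ i → x * a i) b ≈ x * lincomb a b
  lincomb-*ˡ {ℕ.zero}  x a b = sym (zeroʳ x)
  lincomb-*ˡ {ℕ.suc k} x a b =
    trans (+-cong (*-assoc _ _ _) (lincomb-*ˡ x (a ∘ suc) (b ∘ suc))) (sym (distribˡ x _ _))

  lincomb-*ʳ : ∀ {k} x (a b : Fin k → Carrier) → lincomb a (λ i → b i * x) ≈ lincomb a b * x
  lincomb-*ʳ {ℕ.zero}  x a b = sym (zeroˡ x)
  lincomb-*ʳ {ℕ.suc k} x a b =
    trans (+-cong (sym (*-assoc _ _ _)) (lincomb-*ʳ x (a ∘ suc) (b ∘ suc))) (sym (distribʳ x _ _))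

  lincomb-subˡ : ∀ {k} (a a′ b : Fin k → Carrier) →
                 lincomb (λ i → a i - a′ i) b ≈ lincomb a b - lincomb a′ b
  lincomb-subˡ a a′ b = trans (lincomb-+ˡ a (λ i → - a′ i) b) (+-congˡ (begin
    lincomb (λ i → - a′ i) b         ≈⟨ lincomb-cong (λ i → -1*x≈-x (a′ i)) (λ _ → refl) ⟨
    lincomb (λ i → - 1# * a′ i) b    ≈⟨ lincomb-*ˡ (- 1#) a′ b ⟩
    - 1# * lincomb a′ b              ≈⟨ -1*x≈-x _ ⟩
    - lincomb a′ b                   ∎))

  lincomb-0ˡ : ∀ {k} {a : Fin k → Carrier} (b : Fin k → Carrier) → (∀ i → a i ≈ 0#) → lincomb a b ≈ 0#
  lincomb-0ˡ {ℕ.zero}  b a≈0 = refl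
  lincomb-0ˡ {ℕ.suc k} b a≈0 =
    trans (+-cong (x≈0⇒x*y≈0 (b zero) (a≈0 zero)) (lincomb-0ˡ (b ∘ suc) (a≈0 ∘ suc))) (+-identityˡ 0#)

  lincomb-take-drop : ∀ m {k} (a b : Fin (m ℕ.+ k) → Carrier) →
                      lincomb a b ≈ lincomb (take m a) (take m b) + lincomb (drop m a) (drop m b)
  lincomb-take-drop ℕ.zero    a b = sym (+-identityˡ _)
  lincomb-take-drop (ℕ.suc m) a b =
    trans (+-congˡ (lincomb-take-drop m (a ∘ suc) (b ∘ suc))) (sym (+-assoc _ _ _))

  FCoeffs-sub : ∀ {k} {a a′ : Fin k → Carrier} → FCoeffs a → FCoeffs a′ → FCoeffs (λ i → a i - a′ i)
  FCoeffs-sub a∈F a′∈F i = Sub.+-cl (a∈F i) (Sub.neg-cl (a′∈F i))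

  LinIndep⇒coeffs-unique : ∀ {k} {a a′ b : Fin k → Carrier} → LinIndep b → FCoeffs a → FCoeffs a′ →
                           lincomb a b ≈ lincomb a′ b → ∀ i → a i ≈ a′ i
  LinIndep⇒coeffs-unique {a = a} {a′} {b} b-indep a∈F a′∈F eq i = x∙y⁻¹≈ε⇒x≈y _ _
    (b-indep _ (FCoeffs-sub a∈F a′∈F) (trans (lincomb-subˡ a a′ b) (x≈y⇒x∙y⁻¹≈ε eq)) i)

  LinIndep-take : ∀ m {k} {b : Fin (m ℕ.+ k) → Carrier} → LinIndep b → LinIndep (take m b)
  LinIndep-take m {k} {b} b-indep a a∈F eq i =
    trans (reflexive (≡.sym (Vector.lookup-++ˡ a zeros i)))
          (b-indep (a ++ zeros) padded∈F padded≈0 (i ↑ˡ k))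
    where
    zeros : Fin k → Carrier
    zeros _ = 0#
    padded∈F : FCoeffs (a ++ zeros)
    padded∈F = ↑-elim (λ j → F ((a ++ zeros) j))
      (λ i → ≡.subst F (≡.sym (Vector.lookup-++ˡ a zeros i)) (a∈F i))
      (λ i → ≡.subst F (≡.sym (Vector.lookup-++ʳ a zeros i)) Sub.has0)
    padded≈0 : lincomb (a ++ zeros) b ≈ 0#
    padded≈0 = trans (lincomb-take-drop m (a ++ zeros) b) (trans (+-cong
      (trans (lincomb-cong (λ i → reflexive (Vector.lookup-++ˡ a zeros i)) (λ _ → refl)) eq)
      (lincomb-0ˡ (drop m b) (λ i → reflexive (Vector.lookup-++ʳ a zeros i)))) (+-identityˡ 0#))

  lincomb₂-split : ∀ {k} (a : Fin k → Carrier) (b : Fin k → K²) →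
                   lincomb₂ a b ≈₂ (lincomb a (proj₁ ∘ b) , lincomb a (proj₂ ∘ b))
  lincomb₂-split {ℕ.zero}  a b = refl , refl
  lincomb₂-split {ℕ.suc k} a b =
    let e₁ , e₂ = lincomb₂-split (a ∘ suc) (b ∘ suc) in +-congˡ e₁ , +-congˡ e₂

  lincomb₂-congˡ : ∀ {k} {a a′ : Fin k → Carrier} (b : Fin k → K²) →
                   (∀ i → a i ≈ a′ i) → lincomb₂ a b ≈₂ lincomb₂ a′ b
  lincomb₂-congˡ {ℕ.zero}  b a≈a′ = refl , refl
  lincomb₂-congˡ {ℕ.suc k} b a≈a′ = let e₁ , e₂ = lincomb₂-congˡ (b ∘ suc) (a≈a′ ∘ suc) in
    +-cong (*-congʳ (a≈a′ zero)) e₁ , +-cong (*-congʳ (a≈a′ zero)) e₂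

  lincomb₂-*ˡ : ∀ {k} x (a : Fin k → Carrier) (b : Fin k → K²) →
                lincomb₂ (λ i → x * a i) b ≈₂ (x ·₂ lincomb₂ a b)
  lincomb₂-*ˡ {ℕ.zero}  x a b = sym (zeroʳ x) , sym (zeroʳ x)
  lincomb₂-*ˡ {ℕ.suc k} x a b = let e₁ , e₂ = lincomb₂-*ˡ x (a ∘ suc) (b ∘ suc) in
      trans (+-cong (*-assoc _ _ _) e₁) (sym (distribˡ x _ _))
    , trans (+-cong (*-assoc _ _ _) e₂) (sym (distribˡ x _ _))

  LinIndep₂⇒coeffs-unique : ∀ {k} {a a′ : Fin k → Carrier} {b : Fin k → K²} → LinIndep₂ b →
                            FCoeffs a → FCoeffs a′ → lincomb₂ a b ≈₂ lincomb₂ a′ b → ∀ i → a i ≈ a′ i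
  LinIndep₂⇒coeffs-unique {a = a} {a′} {b} b-indep a∈F a′∈F eq i =
    x∙y⁻¹≈ε⇒x≈y _ _ (b-indep _ (FCoeffs-sub a∈F a′∈F) difference≈0 i)
    where
    difference≈0 : lincomb₂ (λ i → a i - a′ i) b ≈₂ 0₂
    difference≈0 = K².trans (lincomb₂-split _ b)
      ( trans (lincomb-subˡ a a′ _) (x≈y⇒x∙y⁻¹≈ε
          (trans (sym (proj₁ (lincomb₂-split a b))) (trans (proj₁ eq) (proj₁ (lincomb₂-split a′ b)))))
      , trans (lincomb-subˡ a a′ _) (x≈y⇒x∙y⁻¹≈ε
          (trans (sym (proj₂ (lincomb₂-split a b))) (trans (proj₂ eq) (proj₂ (lincomb₂-split a′ b))))) )

  InFSpan₂ : ∀ {k} → K² → (Fin k → K²) → Set (c ⊔ ℓ ⊔ p)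
  InFSpan₂ x b = ∃ λ a → FCoeffs a × lincomb₂ a b ≈₂ x

  lincomb₂-closed : ∀ {u} {U : K² → Set u} → OnK².IsSubspace U →
                    ∀ {k} {a : Fin k → Carrier} {b : Fin k → K²} →
                    FCoeffs a → (∀ i → U (b i)) → U (lincomb₂ a b)
  lincomb₂-closed U-subspace {ℕ.zero}  a∈F b∈U = OnK².IsSubspace.has0 U-subspace
  lincomb₂-closed U-subspace {ℕ.suc k} a∈F b∈U = OnK².IsSubspace.+-cl U-subspace
    (OnK².IsSubspace.·-cl U-subspace (a∈F zero) (b∈U zero))
    (lincomb₂-closed U-subspace (a∈F ∘ suc) (b∈U ∘ suc))

  module OnPoint {v : K²} {k} (b : Fin k → K²) (b-on : ∀ i → Span₁ v (b i)) where
    coeff : Fin k → Carrier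
    coeff i = proj₁ (b-on i)

    lincomb₂-on-point : ∀ a → lincomb₂ a b ≈₂ (lincomb a coeff ·₂ v)
    lincomb₂-on-point a = K².trans (lincomb₂-split a b)
      ( trans (lincomb-cong (λ _ → refl) (proj₁ ∘ proj₂ ∘ b-on)) (lincomb-*ʳ (proj₁ v) a coeff)
      , trans (lincomb-cong (λ _ → refl) (proj₂ ∘ proj₂ ∘ b-on)) (lincomb-*ʳ (proj₂ v) a coeff) )

    coeff-independent : LinIndep₂ b → LinIndep coeff
    coeff-independent b-indep a a∈F a·coeff≈0 = b-indep a a∈F
      (K².trans (lincomb₂-on-point a) (x≈0⇒x*y≈0 _ a·coeff≈0 , x≈0⇒x*y≈0 _ a·coeff≈0))

module Finite {c ℓ p : Level} (K : Field c ℓ) {F : Field.Carrier K → Set p}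
              (F-subfield : FieldTheory.IsSubfield K F)
              {q : ℕ.ℕ} (F-size : FieldTheory.HasSize K F q)
              {n : ℕ.ℕ} (degree : FieldTheory.Linear.Degree K F n) where
  open Field K hiding (zero)
  open FieldProperties K
  open FieldTheory K
  open Plane K
  open Linear F
  open OnK using (lincomb; FCoeffs; LinIndep)
  open OnK² using () renaming (lincomb to lincomb₂; LinIndep to LinIndep₂)
  open Combinations K F-subfield
  private
    module Sub = IsSubfield F-subfield

  -- F-valued coefficient vectors of length k are encoded as words γ : Fin k → Fin q via elem.
  elem : Fin q → Carrier
  elem = proj₁ F-size

  elem∈F : ∀ i → F (elem i)
  elem∈F = proj₁ (proj₂ F-size)

  elem-injective : ∀ i j → elem i ≈ elem j → i ≡ j
  elem-injective = proj₂ (proj₂ (proj₂ F-size))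

  index : ∀ {x} → F x → Fin q
  index x∈F = proj₁ (proj₁ (proj₂ (proj₂ F-size)) _ x∈F)

  elem-index : ∀ {x} (x∈F : F x) → elem (index x∈F) ≈ x
  elem-index x∈F = proj₂ (proj₁ (proj₂ (proj₂ F-size)) _ x∈F)

  2≤q : 2 ℕ.≤ q
  2≤q = distinct⇒2≤ λ eq → 0≉1 (trans (sym (elem-index Sub.has0))
    (trans (reflexive (≡.cong elem eq)) (elem-index Sub.has1)))

  word-unique : ∀ {k} {b : Fin k → Carrier} {γ γ′ : Fin k → Fin q} → LinIndep b →
                lincomb (elem ∘ γ) b ≈ lincomb (elem ∘ γ′) b → γ ≗ γ′
  word-unique {γ = γ} {γ′} b-indep eq i =
    elem-injective _ _ (LinIndep⇒coeffs-unique b-indep (elem∈F ∘ γ) (elem∈F ∘ γ′) eq i)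

  word-unique₂ : ∀ {k} {b : Fin k → K²} {γ γ′ : Fin k → Fin q} → LinIndep₂ b →
                 lincomb₂ (elem ∘ γ) b ≈₂ lincomb₂ (elem ∘ γ′) b → γ ≗ γ′
  word-unique₂ {γ = γ} {γ′} b-indep eq i =
    elem-injective _ _ (LinIndep₂⇒coeffs-unique b-indep (elem∈F ∘ γ) (elem∈F ∘ γ′) eq i)

  basis : Fin n → Carrier
  basis = proj₁ degree

  basis-independent : LinIndep basis
  basis-independent = proj₁ (proj₂ (proj₂ degree))

  expansion : ∀ x → ∃ λ a → FCoeffs a × lincomb a basis ≈ x
  expansion x = proj₂ (proj₂ (proj₂ degree)) x tt

  coords : Carrier → Fin n → Fin q
  coords x i = index (proj₁ (proj₂ (expansion x)) i)

  lincomb-coords : ∀ x → lincomb (elem ∘ coords x) basis ≈ x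
  lincomb-coords x = trans (lincomb-cong (λ i → elem-index (proj₁ (proj₂ (expansion x)) i)) (λ _ → refl))
    (proj₂ (proj₂ (expansion x)))

  coords-injective : ∀ {x y} → coords x ≗ coords y → x ≈ y
  coords-injective {x} {y} eq = trans (sym (lincomb-coords x))
    (trans (lincomb-cong (λ i → reflexive (≡.cong elem (eq i))) (λ _ → refl)) (lincomb-coords y))

  coords-cong : ∀ {x y} → x ≈ y → coords x ≗ coords y
  coords-cong {x} {y} x≈y = word-unique basis-independent
    (trans (lincomb-coords x) (trans x≈y (sym (lincomb-coords y))))

  _≟_ : ∀ x y → Dec (x ≈ y)
  x ≟ y = map′ coords-injective coords-cong (Fin.all? λ i → coords x i Fin.≟ coords y i)

  _≟₂_ : ∀ x y → Dec (x ≈₂ y)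
  x ≟₂ y = (proj₁ x ≟ proj₁ y) ×-dec (proj₂ x ≟ proj₂ y)

  coords₂ : K² → Fin (n ℕ.+ n) → Fin q
  coords₂ (x₁ , x₂) = coords x₁ ++ coords x₂

  coords₂-injective : ∀ {x y} → coords₂ x ≗ coords₂ y → x ≈₂ y
  coords₂-injective eq =
    coords-injective (Vector.++-injectiveˡ _ _ eq) , coords-injective (Vector.++-injectiveʳ _ _ eq)

  LinIndep⇒≤degree : ∀ {k} {b : Fin k → Carrier} → LinIndep b → k ℕ.≤ n
  LinIndep⇒≤degree {b = b} b-indep =
    pointwise-injection⇒≤ 2≤q (λ γ → coords (lincomb (elem ∘ γ) b))
      λ γ γ′ eq → word-unique b-indep (coords-injective eq)

  LinIndep₂⇒≤2*degree : ∀ {k} {b : Fin k → K²} → LinIndep₂ b → k ℕ.≤ n ℕ.+ n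
  LinIndep₂⇒≤2*degree {b = b} b-indep =
    pointwise-injection⇒≤ 2≤q (λ γ → coords₂ (lincomb₂ (elem ∘ γ) b))
      λ γ γ′ eq → word-unique₂ b-indep (coords₂-injective eq)

  InFSpan₂? : ∀ {k} x (b : Fin k → K²) → Dec (InFSpan₂ x b)
  InFSpan₂? x b = map′ (λ (γ , eq) → elem ∘ γ , elem∈F ∘ γ , eq)
    (λ (a , a∈F , eq) → (λ i → index (a∈F i)) , K².trans (lincomb₂-congˡ b (elem-index ∘ a∈F)) eq)
    (any-word? (λ γ≗γ′ → K².trans (lincomb₂-congˡ b λ i → reflexive (≡.cong elem (≡.sym (γ≗γ′ i)))))
               (λ γ → lincomb₂ (elem ∘ γ) b ≟₂ x))

  LinIndep₂-∷ : ∀ {k} {b : Fin k → K²} {x} → LinIndep₂ b → ¬ InFSpan₂ x b → LinIndep₂ (x ∷ b)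
  LinIndep₂-∷ {k} {b} {x} b-indep x∉span a a∈F eq with a zero ≟ 0#
  ... | yes a₀≈0 = λ { zero → a₀≈0 ; (suc i) → b-indep (a ∘ suc) (a∈F ∘ suc) rest≈0 i }
    where
    rest≈0 : lincomb₂ (a ∘ suc) b ≈₂ 0₂
    rest≈0 = x≈0⇒x+y≈0⇒y≈0 (x≈0⇒x*y≈0 _ a₀≈0) (proj₁ eq)
           , x≈0⇒x+y≈0⇒y≈0 (x≈0⇒x*y≈0 _ a₀≈0) (proj₂ eq)
  ... | no a₀≉0 = ⊥-elim (x∉span (a′ , a′∈F , K².trans (lincomb₂-*ˡ (- a₀⁻¹) (a ∘ suc) b)
                    (K².sym (ax+r≈0⇒x≈-a⁻¹r a₀a₀⁻¹≈1 (proj₁ eq)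
                           , ax+r≈0⇒x≈-a⁻¹r a₀a₀⁻¹≈1 (proj₂ eq)))))
    where
    a₀⁻¹ : Carrier
    a₀⁻¹ = proj₁ (inverse (a zero) a₀≉0)
    a₀a₀⁻¹≈1 : a zero * a₀⁻¹ ≈ 1#
    a₀a₀⁻¹≈1 = proj₂ (inverse (a zero) a₀≉0)
    a′ : Fin k → Carrier
    a′ i = (- a₀⁻¹) * a (suc i)
    a′∈F : FCoeffs a′
    a′∈F i = Sub.*-cl (Sub.neg-cl (Sub.inv-cl (a∈F zero) a₀a₀⁻¹≈1)) (a∈F (suc i))

  -- Only doubly negated: S is an arbitrary predicate, so whether b already spans S is undecidable.
  ¬¬-extends-to-basis : ∀ {s} (S : K² → Set s) {k} (b : Fin k → K²) →
                        (∀ i → S (b i)) → LinIndep₂ b → ¬ (∀ m → k ℕ.≤ m → ¬ OnK².HasDim S m)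
  ¬¬-extends-to-basis S {k} =
    extend (ℕ.suc (n ℕ.+ n)) (ℕ.<-≤-trans (ℕ.n<1+n (n ℕ.+ n)) (ℕ.m≤n+m _ k))
    where
    -- Adding vectors outside the span terminates: independent families have length at most n + n.
    extend : ∀ slack {k} → n ℕ.+ n ℕ.< k ℕ.+ slack → (b : Fin k → K²) →
             (∀ i → S (b i)) → LinIndep₂ b → ¬ (∀ m → k ℕ.≤ m → ¬ OnK².HasDim S m)
    extend ℕ.zero {k} n+n<k+0 b _ b-indep _ =
      ℕ.<⇒≱ (≡.subst (n ℕ.+ n ℕ.<_) (ℕ.+-identityʳ k) n+n<k+0) (LinIndep₂⇒≤2*degree b-indep)
    extend (ℕ.suc slack) {k} n+n<k+1+slack b b∈S b-indep no-basis =
      no-basis k ℕ.≤-refl (b , b∈S , b-indep , spans)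
      where
      spans : OnK².Spans S b
      spans x x∈S with InFSpan₂? x b
      ... | yes x∈span = x∈span
      ... | no x∉span = ⊥-elim (extend slack (≡.subst (n ℕ.+ n ℕ.<_) (ℕ.+-suc k slack) n+n<k+1+slack)
                                  (x ∷ b) (λ { zero → x∈S ; (suc i) → b∈S i }) (LinIndep₂-∷ b-indep x∉span)
                                  (λ m k<m → no-basis m (ℕ.<⇒≤ k<m)))

  independent-pair⇒¬¬WeightGt1 : ∀ {u} {U : K² → Set u} {v v′ : K²} →
                                 U v → U v′ → Span₁ v v′ → LinIndep₂ (v ∷ v′ ∷ []) → ¬ ¬ WeightGt1 U v
  independent-pair⇒¬¬WeightGt1 {U = U} {v} {v′} v∈U v′∈U v′∈⟨v⟩ pair-indep light =
    ¬¬-extends-to-basis (λ x → U x × Span₁ v x) (v ∷ v′ ∷ []) pair∈S pair-indep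
      λ m 2≤m basis → light (m , 2≤m , basis)
    where
    pair∈S : ∀ i → U ((v ∷ v′ ∷ []) i) × Span₁ v ((v ∷ v′ ∷ []) i)
    pair∈S zero       = v∈U , 1# , sym (*-identityˡ _) , sym (*-identityˡ _)
    pair∈S (suc zero) = v′∈U , v′∈⟨v⟩

  ·₂-cancel : ∀ {y} {v : K²} → ¬ v ≈₂ 0₂ → (y ·₂ v) ≈₂ 0₂ → y ≈ 0#
  ·₂-cancel {y} v≉0 yv≈0 with y ≟ 0#
  ... | yes y≈0 = y≈0
  ... | no y≉0  = ⊥-elim (v≉0 (*-cancelˡ-≉0 y≉0 (proj₁ yv≈0) , *-cancelˡ-≉0 y≉0 (proj₂ yv≈0)))

  distinct-points-independent : ∀ {u v : K²} {x y} → ¬ SamePoint u v → ¬ v ≈₂ 0₂ →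
                                ((x ·₂ u) +₂ (y ·₂ v)) ≈₂ 0₂ → x ≈ 0# × y ≈ 0#
  distinct-points-independent {x = x} {y} u≁v v≉0 eq with x ≟ 0#
  ... | yes x≈0 = x≈0 , ·₂-cancel v≉0
          ( x≈0⇒x+y≈0⇒y≈0 (x≈0⇒x*y≈0 _ x≈0) (proj₁ eq)
          , x≈0⇒x+y≈0⇒y≈0 (x≈0⇒x*y≈0 _ x≈0) (proj₂ eq) )
  ... | no x≉0 = ⊥-elim (u≁v ((- x⁻¹) * y
          , trans (ax+r≈0⇒x≈-a⁻¹r xx⁻¹≈1 (proj₁ eq)) (sym (*-assoc _ _ _))
          , trans (ax+r≈0⇒x≈-a⁻¹r xx⁻¹≈1 (proj₂ eq)) (sym (*-assoc _ _ _))))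
    where
    x⁻¹ : Carrier
    x⁻¹ = proj₁ (inverse x x≉0)
    xx⁻¹≈1 : x * x⁻¹ ≈ 1#
    xx⁻¹≈1 = proj₂ (inverse x x≉0)

  distinct-points-coeffs-unique : ∀ {u v : K²} {x x′ y y′} → ¬ SamePoint u v → ¬ v ≈₂ 0₂ →
                                  ((x ·₂ u) +₂ (y ·₂ v)) ≈₂ ((x′ ·₂ u) +₂ (y′ ·₂ v)) →
                                  x ≈ x′ × y ≈ y′
  distinct-points-coeffs-unique u≁v v≉0 (eq₁ , eq₂) =
    let x-x′≈0 , y-y′≈0 =
          distinct-points-independent u≁v v≉0 ([x-x′]a+[y-y′]b≈0 eq₁ , [x-x′]a+[y-y′]b≈0 eq₂)
    in x∙y⁻¹≈ε⇒x≈y _ _ x-x′≈0 , x∙y⁻¹≈ε⇒x≈y _ _ y-y′≈0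

module TwoHeavyPoints {c ℓ p : Level} (K : Field c ℓ) {F : Field.Carrier K → Set p}
    (F-subfield : FieldTheory.IsSubfield K F)
    {q : ℕ.ℕ} (F-size : FieldTheory.HasSize K F q)
    {n : ℕ.ℕ} (degree : FieldTheory.Linear.Degree K F n) where
  open Field K hiding (zero)
  open FieldProperties K
  open FieldTheory K
  open Plane K
  open Linear F
  open OnK using (lincomb; FCoeffs; LinIndep)
  open OnK² using () renaming (LinIndep to LinIndep₂)
  open Combinations K F-subfield
  open Finite K F-subfield F-size degree
  open import Relation.Binary.Reasoning.Setoid setoid
  open import Algebra.Solver.Ring.NaturalCoefficients.Default commutativeSemiring
    using (solve; _:+_; _:*_; _:=_; con)
  private
    module Sub = IsSubfield F-subfield

  module _ {u : Level} {U : K² → Set u} (U-subspace : OnK².IsSubspace U)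
           {P Q : K²} (Q≉0 : ¬ Q ≈₂ 0₂) (P≁Q : ¬ SamePoint P Q)
           (only : ∀ R → ¬ R ≈₂ 0₂ → WeightGt1 U R → SamePoint R P ⊎ SamePoint R Q) where
    private
      module U = OnK².IsSubspace U-subspace

    module _ {ν : Fin 2 → Carrier} (ν-independent : LinIndep ν) (νQ∈U : ∀ i → U (ν i ·₂ Q)) where
      ν₁ ν₂ : Carrier
      ν₁ = ν zero
      ν₂ = ν (suc zero)

      ν-pair-independent : ∀ {c₁ c₂} → F c₁ → F c₂ → c₁ * ν₁ + c₂ * ν₂ ≈ 0# → c₁ ≈ 0# × c₂ ≈ 0#
      ν-pair-independent {c₁} {c₂} c₁∈F c₂∈F eq = c≈0 zero , c≈0 (suc zero)
        where
        c∈F : FCoeffs (c₁ ∷ c₂ ∷ [])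
        c∈F zero       = c₁∈F
        c∈F (suc zero) = c₂∈F
        c≈0 : ∀ i → (c₁ ∷ c₂ ∷ []) i ≈ 0#
        c≈0 = ν-independent _ c∈F (trans (+-congˡ (+-identityʳ _)) eq)

      ν₁≉0 : ¬ ν₁ ≈ 0#
      ν₁≉0 ν₁≈0 = 0≉1 (sym (proj₁ (ν-pair-independent Sub.has1 Sub.has0
        (trans (+-cong (trans (*-identityˡ ν₁) ν₁≈0) (zeroˡ ν₂)) (+-identityˡ 0#)))))

      -- Otherwise dP + ν₁Q and eP + ν₂Q are F-independent vectors of U on one point, which is neither P nor Q.
      collinear⇒≈0 : ∀ {d e} → U (d ·₂ P) → U (e ·₂ P) → d * ν₂ ≈ e * ν₁ → d ≈ 0#
      collinear⇒≈0 {d} {e} dP∈U eP∈U dν₂≈eν₁ with d ≟ 0#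
      ... | yes d≈0 = d≈0
      ... | no d≉0  = ⊥-elim (independent-pair⇒¬¬WeightGt1 u₁∈U u₂∈U u₂∈⟨u₁⟩ u-independent u₁-light)
        where
        u₁ u₂ : K²
        u₁ = (d ·₂ P) +₂ (ν₁ ·₂ Q)
        u₂ = (e ·₂ P) +₂ (ν₂ ·₂ Q)

        u₁∈U : U u₁
        u₁∈U = U.+-cl dP∈U (νQ∈U zero)

        u₂∈U : U u₂
        u₂∈U = U.+-cl eP∈U (νQ∈U (suc zero))

        ν₁⁻¹ : Carrier
        ν₁⁻¹ = proj₁ (inverse ν₁ ν₁≉0)

        ν₁ν₁⁻¹≈1 : ν₁ * ν₁⁻¹ ≈ 1#
        ν₁ν₁⁻¹≈1 = proj₂ (inverse ν₁ ν₁≉0)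

        proportional : ∀ a b → e * a + ν₂ * b ≈ (ν₂ * ν₁⁻¹) * (d * a + ν₁ * b)
        proportional a b = sym (begin
          (ν₂ * ν₁⁻¹) * (d * a + ν₁ * b)
            ≈⟨ solve 6 (λ ν₂ i d a ν₁ b → (ν₂ :* i) :* (d :* a :+ ν₁ :* b)
                                         := (i :* (d :* ν₂)) :* a :+ (ν₁ :* i) :* (ν₂ :* b))
                       refl ν₂ ν₁⁻¹ d a ν₁ b ⟩
          (ν₁⁻¹ * (d * ν₂)) * a + (ν₁ * ν₁⁻¹) * (ν₂ * b)
            ≈⟨ +-cong (*-congʳ (*-congˡ dν₂≈eν₁)) (*-congʳ ν₁ν₁⁻¹≈1) ⟩
          (ν₁⁻¹ * (e * ν₁)) * a + 1# * (ν₂ * b)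
            ≈⟨ +-cong (*-congʳ (solve 3 (λ i e ν₁ → i :* (e :* ν₁) := (ν₁ :* i) :* e) refl ν₁⁻¹ e ν₁))
                      (*-identityˡ _) ⟩
          ((ν₁ * ν₁⁻¹) * e) * a + ν₂ * b
            ≈⟨ +-congʳ (*-congʳ (trans (*-congʳ ν₁ν₁⁻¹≈1) (*-identityˡ e))) ⟩
          e * a + ν₂ * b ∎)

        u₂∈⟨u₁⟩ : Span₁ u₁ u₂
        u₂∈⟨u₁⟩ = ν₂ * ν₁⁻¹ , proportional (proj₁ P) (proj₁ Q) , proportional (proj₂ P) (proj₂ Q)

        regroup : ∀ c₁ c₂ a b → c₁ * (d * a + ν₁ * b) + (c₂ * (e * a + ν₂ * b) + 0#)
                                ≈ (c₁ * d + c₂ * e) * a + (c₁ * ν₁ + c₂ * ν₂) * b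
        regroup c₁ c₂ a b = solve 8 (λ c₁ c₂ d e ν₁ ν₂ a b →
            c₁ :* (d :* a :+ ν₁ :* b) :+ (c₂ :* (e :* a :+ ν₂ :* b) :+ con 0)
            := (c₁ :* d :+ c₂ :* e) :* a :+ (c₁ :* ν₁ :+ c₂ :* ν₂) :* b) refl c₁ c₂ d e ν₁ ν₂ a b

        u-independent : LinIndep₂ (u₁ ∷ u₂ ∷ [])
        u-independent c c∈F (eq₁ , eq₂) = λ { zero → proj₁ c≈0 ; (suc zero) → proj₂ c≈0 }
          where
          c≈0 : c zero ≈ 0# × c (suc zero) ≈ 0#
          c≈0 = ν-pair-independent (c∈F zero) (c∈F (suc zero)) (proj₂ (distinct-points-independent P≁Q Q≉0
                  (trans (sym (regroup _ _ _ _)) eq₁ , trans (sym (regroup _ _ _ _)) eq₂)))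

        u₁≉0 : ¬ u₁ ≈₂ 0₂
        u₁≉0 u₁≈0 = ν₁≉0 (proj₂ (distinct-points-independent P≁Q Q≉0 u₁≈0))

        u₁-light : ¬ WeightGt1 U u₁
        u₁-light heavy with only u₁ u₁≉0 heavy
        ... | inj₁ (m , u₁≈mP) = ν₁≉0 (proj₂ (distinct-points-coeffs-unique P≁Q Q≉0
                (K².trans u₁≈mP (sym (x+0*y≈x _ _) , sym (x+0*y≈x _ _)))))
        ... | inj₂ (m , u₁≈mQ) = d≉0 (proj₁ (distinct-points-coeffs-unique P≁Q Q≉0
                (K².trans u₁≈mQ (sym (0*x+y≈y _ _) , sym (0*x+y≈y _ _)))))

      scaled-family-independent : ∀ {w} {μ : Fin w → Carrier} → LinIndep μ →
                                  (∀ a → FCoeffs a → U (lincomb a μ ·₂ P)) →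
                                  LinIndep ((λ i → μ i * ν₂) ++ (λ i → μ i * - ν₁))
      scaled-family-independent {w} {μ} μ-independent μP∈U a a∈F eq =
        ↑-elim (λ j → a j ≈ 0#) (μ-independent (take w a) (a∈F ∘ (_↑ˡ w)) d≈0)
                                (μ-independent (drop w a) (a∈F ∘ (w ↑ʳ_)) e≈0)
        where
        left right : Fin w → Carrier
        left i = μ i * ν₂
        right i = μ i * - ν₁

        family : Fin (w ℕ.+ w) → Carrier
        family = left ++ right

        d e : Carrier
        d = lincomb (take w a) μ
        e = lincomb (drop w a) μ

        dν₂≈eν₁ : d * ν₂ ≈ e * ν₁
        dν₂≈eν₁ = x∙y⁻¹≈ε⇒x≈y _ _ (begin
          d * ν₂ - e * ν₁
            ≈⟨ +-congˡ (-‿distribʳ-* e ν₁) ⟩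
          d * ν₂ + e * - ν₁
            ≈⟨ +-cong (lincomb-*ʳ ν₂ (take w a) μ) (lincomb-*ʳ (- ν₁) (drop w a) μ) ⟨
          lincomb (take w a) left + lincomb (drop w a) right
            ≈⟨ +-cong (lincomb-cong (λ _ → refl) (reflexive ∘ Vector.lookup-++ˡ left right))
                      (lincomb-cong (λ _ → refl) (reflexive ∘ Vector.lookup-++ʳ left right)) ⟨
          lincomb (take w a) (take w family) + lincomb (drop w a) (drop w family)
            ≈⟨ lincomb-take-drop w a family ⟨
          lincomb a family
            ≈⟨ eq ⟩
          0# ∎)

        d≈0 : d ≈ 0#
        d≈0 = collinear⇒≈0 (μP∈U (take w a) (a∈F ∘ (_↑ˡ w))) (μP∈U (drop w a) (a∈F ∘ (w ↑ʳ_)))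
                           dν₂≈eν₁

        e≈0 : e ≈ 0#
        e≈0 = *-cancelˡ-≉0 ν₁≉0 (trans (*-comm ν₁ e) (trans (sym dν₂≈eν₁) (x≈0⇒x*y≈0 ν₂ d≈0)))

    weight-bound : ∀ {w} → Weight U P w → WeightGt1 U Q → 2 ℕ.* w ℕ.≤ n
    weight-bound {w} (bP , bP∈S , bP-independent , _)
                     (_ , ℕ.s≤s (ℕ.s≤s (ℕ.z≤n {r})) , bQ , bQ∈S , bQ-independent , _) =
      ≡.subst (ℕ._≤ n) (≡.cong (w ℕ.+_) (≡.sym (ℕ.+-identityʳ w)))
        (LinIndep⇒≤degree (scaled-family-independent ν-independent νQ∈U μ-independent μP∈U))
      where
      module OnP = OnPoint bP (proj₂ ∘ bP∈S)
      module OnQ = OnPoint bQ (proj₂ ∘ bQ∈S)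

      μ-independent : LinIndep OnP.coeff
      μ-independent = OnP.coeff-independent bP-independent

      μP∈U : ∀ a → FCoeffs a → U (lincomb a OnP.coeff ·₂ P)
      μP∈U a a∈F = U.resp (OnP.lincomb₂-on-point a) (lincomb₂-closed U-subspace a∈F (proj₁ ∘ bP∈S))

      ν-independent : LinIndep (take 2 OnQ.coeff)
      ν-independent = LinIndep-take 2 {b = OnQ.coeff} (OnQ.coeff-independent bQ-independent)

      νQ∈U : ∀ i → U (take 2 OnQ.coeff i ·₂ Q)
      νQ∈U i = U.resp (proj₂ (proj₂ (bQ∈S (i ↑ˡ r)))) (proj₁ (bQ∈S (i ↑ˡ r)))

open import Data.Nat using (ℕ; _+_; _*_; _≤_; _<_)

half-bounds⇒sum≤ : ∀ a b {n} → 2 * a ≤ n → 2 * b ≤ n → a + b ≤ n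
half-bounds⇒sum≤ a b {n} 2a≤n 2b≤n = ℕ.*-cancelˡ-≤ 2 (begin
  2 * (a + b)      ≡⟨ ℕ.*-distribˡ-+ 2 a b ⟩
  2 * a + 2 * b    ≤⟨ ℕ.+-mono-≤ 2a≤n 2b≤n ⟩
  n + n            ≡⟨ ≡.cong (n +_) (ℕ.+-identityʳ n) ⟨
  2 * n            ∎)
  where open ℕ.≤-Reasoning

half-bounds⇒twice≡ : ∀ a b {n} → 2 * a ≤ n → 2 * b ≤ n → a + b ≡ n → 2 * a ≡ n
half-bounds⇒twice≡ a b {n} 2a≤n 2b≤n a+b≡n = ℕ.≤-antisym 2a≤n (ℕ.+-cancelʳ-≤ n n (2 * a) (begin
  n + n            ≡⟨ ≡.cong (n +_) (ℕ.+-identityʳ n) ⟨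
  2 * n            ≡⟨ ≡.cong (2 *_) a+b≡n ⟨
  2 * (a + b)      ≡⟨ ℕ.*-distribˡ-+ 2 a b ⟩
  2 * a + 2 * b    ≤⟨ ℕ.+-monoʳ-≤ (2 * a) 2b≤n ⟩
  2 * a + n        ∎))
  where open ℕ.≤-Reasoning

theorem4p4 : ∀ {c ℓ p u : Level} (K : Field c ℓ) (F : Field.Carrier K → Set p) (q n : ℕ) →
    FieldTheory.IsSubfield K F →
    FieldTheory.HasSize K F q →
    FieldTheory.Linear.Degree K F n →
    (U : FieldTheory.K² K → Set u) →
    FieldTheory.Linear.OnK².IsSubspace K F U →
    (P Q : FieldTheory.K² K) →
    ¬ FieldTheory._≈₂_ K P (FieldTheory.0₂ K) →
    ¬ FieldTheory._≈₂_ K Q (FieldTheory.0₂ K) →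
    ¬ FieldTheory.SamePoint K P Q →
    FieldTheory.Linear.WeightGt1 K F U P →
    FieldTheory.Linear.WeightGt1 K F U Q →
    (∀ R → ¬ FieldTheory._≈₂_ K R (FieldTheory.0₂ K) →
       FieldTheory.Linear.WeightGt1 K F U R →
       FieldTheory.SamePoint K R P ⊎ FieldTheory.SamePoint K R Q) →
    (wP wQ : ℕ) →
    FieldTheory.Linear.Weight K F U P wP →
    FieldTheory.Linear.Weight K F U Q wQ →
    (2 * wP ≤ n × 2 * wQ ≤ n)
    × (¬ (2 ∣ n) → wP + wQ < n)
    × (wP + wQ ≡ n → (2 ∣ n) × (2 * wP ≡ n) × (2 * wQ ≡ n))
theorem4p4 K F q n F-subfield F-size degree U U-subspace P Q P≉0 Q≉0 P≁Q P-heavy Q-heavy only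
           wP wQ P-weight Q-weight =
  (2wP≤n , 2wQ≤n) , sum<n , λ sum≡n → even sum≡n , 2wP≡n sum≡n , 2wQ≡n sum≡n
  where
  2wP≤n : 2 * wP ≤ n
  2wP≤n = TwoHeavyPoints.weight-bound K F-subfield F-size degree
            U-subspace Q≉0 P≁Q only P-weight Q-heavy

  2wQ≤n : 2 * wQ ≤ n
  2wQ≤n = TwoHeavyPoints.weight-bound K F-subfield F-size degree
            U-subspace P≉0 (P≁Q ∘ Plane.SamePoint-sym K Q≉0) (λ R R≉0 → swap ∘ only R R≉0) Q-weight P-heavy

  2wP≡n : wP + wQ ≡ n → 2 * wP ≡ n
  2wP≡n = half-bounds⇒twice≡ wP wQ 2wP≤n 2wQ≤n

  2wQ≡n : wP + wQ ≡ n → 2 * wQ ≡ n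
  2wQ≡n sum≡n = half-bounds⇒twice≡ wQ wP 2wQ≤n 2wP≤n (≡.trans (ℕ.+-comm wQ wP) sum≡n)

  even : wP + wQ ≡ n → 2 ∣ n
  even sum≡n = divides wP (≡.trans (≡.sym (2wP≡n sum≡n)) (ℕ.*-comm 2 wP))

  sum<n : ¬ (2 ∣ n) → wP + wQ < n
  sum<n odd = ℕ.≤∧≢⇒< (half-bounds⇒sum≤ wP wQ 2wP≤n 2wQ≤n) (odd ∘ even)
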